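{- For every $V\in\Sigma_\$^+$ and all $i,j\in[1..|V|]$, $\mathrm{RTS}(\mathrm{rot}^i(V))[j]=\mathrm{rot}^i(\mathrm{RTS}(V))[j]$.
   Context: $\Sigma=[0..\sigma]$ integer alphabet, $\$\notin\Sigma$ smaller than every integer, $\Sigma_\$=\Sigma\cup\{\$\}$, $\infty$ larger than every integer. Strings 1-indexed; $X[i..]=X[i..|X|]$. $\mathrm{rot}^0(X)=X$, $\mathrm{rot}^{k+1}(X)=\mathrm{rot}^k(X)[2..]\cdot\mathrm{rot}^k(X)[1]$. $\mathrm{rank}_c(X,j)$ = occurrences of $c$ in $X[1..j]$. $\mathrm{PD}(V)[i]=\infty$ if $V[i]\neq\$$ and $V[i]<V[j]$ for all $j<i$; $=\$$ if $V[i]=\$$; otherwise $i-\max\{j<i:V[j]\le V[i]\}$. Rotational Cartesian tree signature encoding: $\mathrm{RTS}(V)$ has length $|V|$, $\mathrm{RTS}(V)[i]=\$$ if $V[i]=\$$, and otherwise $\mathrm{RTS}(V)[i]=\mathrm{rank}_\infty(\mathrm{PD}(\mathrm{rot}^i(V)),|V|)-\mathrm{rank}_\infty(\mathrm{PD}(V[i]\cdot\mathrm{rot}^i(V))[2..],|V|)$. -}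

module Defs where

open import Data.Nat using (ℕ; zero; suc; _≤ᵇ_; _≤_)
open import Data.Integer using (ℤ; _⊖_)
open import Data.Bool using (Bool; true; false; if_then_else_)
open import Data.Maybe using (Maybe; just; nothing)
open import Data.List using (List; []; _∷_; _++_; [_]; length; map; upTo; take; drop)
open import Function using (_∘_)

-- Σ_$ symbols: 'nothing' is the sentinel $ (smaller than every integer),
-- 'just x' is the integer x.
Sym : Set
Sym = Maybe ℕ

OverΣ$ : ℕ → List Sym → Set
OverΣ$ σ [] = Data.Unit.⊤ where import Data.Unit
OverΣ$ σ (nothing ∷ xs) = OverΣ$ σ xs
OverΣ$ σ (just x ∷ xs) = (x ≤ σ) Data.Product.× OverΣ$ σ xs where import Data.Product

_≤S_ : Sym → Sym → Bool
nothing ≤S _ = true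
just _ ≤S nothing = false
just x ≤S just y = x ≤ᵇ y

-- 1-indexed access X[i]
nth : {A : Set} → List A → ℕ → Maybe A
nth [] _ = nothing
nth (x ∷ xs) zero = nothing
nth (x ∷ xs) (suc zero) = just x
nth (x ∷ xs) (suc (suc i)) = nth xs (suc i)

rot1 : {A : Set} → List A → List A
rot1 [] = []
rot1 (x ∷ xs) = xs ++ [ x ]

rot : {A : Set} → ℕ → List A → List A
rot zero X = X
rot (suc k) X = rot1 (rot k X)

data PDSym : Set where
  inf : PDSym
  dol : PDSym
  num : ℕ → PDSym

-- given the prefix V[1..i-1] in reverse order and V[i] = c (an integer),
-- d = current distance: return ∞ if no earlier V[j] ≤ c, else i - max{j<i : V[j] ≤ c}
pdAux : ℕ → List Sym → Sym → PDSym
pdAux d [] c = inf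
pdAux d (y ∷ ys) c = if y ≤S c then num d else pdAux (suc d) ys c

pdGo : List Sym → List Sym → List PDSym
pdGo rev [] = []
pdGo rev (nothing ∷ xs) = dol ∷ pdGo (nothing ∷ rev) xs
pdGo rev (just x ∷ xs) = pdAux 1 rev (just x) ∷ pdGo (just x ∷ rev) xs

PD : List Sym → List PDSym
PD V = pdGo [] V

isInf : PDSym → ℕ
isInf inf = 1
isInf dol = 0
isInf (num _) = 0

count : List PDSym → ℕ
count [] = 0
count (x ∷ xs) = isInf x Data.Nat.+ count xs

rank∞ : List PDSym → ℕ → ℕ
rank∞ X j = count (take j X)

-- RTS symbols: 'nothing' is $, 'just z' an integer
RTSSym : Set
RTSSym = Maybe ℤ

rtsAt : List Sym → ℕ → RTSSym
rtsAt V i with nth V i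
... | nothing = nothing            -- unreachable for i ∈ [1..|V|]
... | just nothing = nothing
... | just (just x) =
  just (rank∞ (PD (rot i V)) (length V)
        ⊖ rank∞ (drop 1 (PD (just x ∷ rot i V))) (length V))

RTS : List Sym → List RTSSym
RTS V = map (λ k → rtsAt V (suc k)) (upTo (length V))

-- RTS(V)[i] depends only on |V| and on the rotation rot^i(V), whose last
-- symbol is V[i]. Hence RTS(rot^i(V))[j] is the value at rot^j(rot^i(V)) =
-- rot^(i+j)(V), while rot^i(RTS(V))[j] is RTS(V)[i+j] read cyclically, i.e.
-- the value at rot^(i+j mod |V|)(V); the two rotations agree because
-- rot^|V| is the identity.
module Submission where

open import Defs
open import Data.Nat using (ℕ; suc; _≤_)
open import Data.List using (List; _∷_; length)
open import Relation.Binary.PropositionalEquality using (_≡_)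

open import Data.Nat using (zero; _+_; _<_; z≤n; s≤s)
open import Data.Nat.Properties
  using (+-comm; +-suc; +-cancelˡ-≤; +-mono-≤; ≤-refl; ≤-<-connex; m≤n⇒∃[o]m+o≡n; m≤n⇒m⊓n≡m)
open import Data.List using ([]; _++_; [_]; last; map; applyUpTo; upTo; take; drop)
open import Data.List.Properties
  using (++-assoc; ++-identityʳ; length-++; length-++-comm; length-map; length-upTo; length-take; take++drop≡id)
open import Data.Maybe using (just; nothing) renaming (map to mapMaybe)
open import Data.Integer using (_⊖_)
open import Data.Product using (Σ; _×_; _,_)
open import Data.Sum using (inj₁; inj₂)
open import Function using (_∘_)
open import Relation.Binary.PropositionalEquality using (refl; sym; trans; cong; cong₂; subst; module ≡-Reasoning)

private
  variable
    A B : Set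

nth-++ˡ : (P Q : List A) (j : ℕ) → j ≤ length P → nth (P ++ Q) j ≡ nth P j
nth-++ˡ []      []      zero          _       = refl
nth-++ˡ []      (_ ∷ _) zero          _       = refl
nth-++ˡ (x ∷ P) Q       zero          _       = refl
nth-++ˡ (x ∷ P) Q       (suc zero)    _       = refl
nth-++ˡ (x ∷ P) Q       (suc (suc j)) (s≤s p) = nth-++ˡ P Q (suc j) p

nth-++ʳ : (P Q : List A) (j : ℕ) → nth (P ++ Q) (length P + suc j) ≡ nth Q (suc j)
nth-++ʳ []          Q j = refl
nth-++ʳ (x ∷ [])    Q j = refl
nth-++ʳ (x ∷ y ∷ P) Q j = nth-++ʳ (y ∷ P) Q j

nth-length : (P : List A) → nth P (length P) ≡ last P
nth-length []          = refl
nth-length (x ∷ [])    = refl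
nth-length (x ∷ y ∷ P) = nth-length (y ∷ P)

last-++-∷ : (S : List A) (x : A) (P : List A) → last (S ++ x ∷ P) ≡ last (x ∷ P)
last-++-∷ []          x P = refl
last-++-∷ (s ∷ [])    x P = refl
last-++-∷ (s ∷ t ∷ S) x P = last-++-∷ (t ∷ S) x P

nth-map : (f : A → B) (X : List A) (k : ℕ) → nth (map f X) k ≡ mapMaybe f (nth X k)
nth-map f []      k             = refl
nth-map f (x ∷ X) zero          = refl
nth-map f (x ∷ X) (suc zero)    = refl
nth-map f (x ∷ X) (suc (suc k)) = nth-map f X (suc k)

nth-applyUpTo : (f : ℕ → A) (n k : ℕ) → k < n → nth (applyUpTo f n) (suc k) ≡ just (f k)
nth-applyUpTo f (suc n) zero    _       = refl
nth-applyUpTo f (suc n) (suc k) (s≤s p) = nth-applyUpTo (f ∘ suc) n k p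

split-at : (i : ℕ) (X : List A) → i ≤ length X →
           Σ (List A) λ P → Σ (List A) λ S → P ++ S ≡ X × length P ≡ i
split-at i X p = take i X , drop i X , take++drop≡id i X , trans (length-take i X) (m≤n⇒m⊓n≡m p)

rot-sucʳ : (k : ℕ) (X : List A) → rot (suc k) X ≡ rot k (rot1 X)
rot-sucʳ zero    X = refl
rot-sucʳ (suc k) X = cong rot1 (rot-sucʳ k X)

rot-+ : (a b : ℕ) (X : List A) → rot (a + b) X ≡ rot a (rot b X)
rot-+ zero    b X = refl
rot-+ (suc a) b X = cong rot1 (rot-+ a b X)

rot-++ : (P S : List A) → rot (length P) (P ++ S) ≡ S ++ P
rot-++ []      S = sym (++-identityʳ S)
rot-++ (x ∷ P) S = begin
  rot (suc (length P)) (x ∷ P ++ S)   ≡⟨ rot-sucʳ (length P) (x ∷ P ++ S) ⟩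
  rot (length P) ((P ++ S) ++ [ x ])  ≡⟨ cong (rot (length P)) (++-assoc P S [ x ]) ⟩
  rot (length P) (P ++ (S ++ [ x ]))  ≡⟨ rot-++ P (S ++ [ x ]) ⟩
  (S ++ [ x ]) ++ P                   ≡⟨ ++-assoc S [ x ] P ⟩
  S ++ x ∷ P                          ∎
  where open ≡-Reasoning

rot-length : (X : List A) → rot (length X) X ≡ X
rot-length X = trans (cong (rot (length X)) (sym (++-identityʳ X))) (rot-++ X [])

length-rot : (k : ℕ) (X : List A) → length (rot k X) ≡ length X
length-rot zero    X       = refl
length-rot (suc k) X with rot k X | length-rot k X
... | []    | e = e
... | x ∷ Y | e = trans (length-++ Y) (trans (+-comm (length Y) 1) e)

nth-rot-++ : (P S : List A) (j : ℕ) → suc j ≤ length (P ++ S) →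
             nth (rot (length P) (P ++ S)) (suc j) ≡ nth ((P ++ S) ++ (P ++ S)) (length P + suc j)
nth-rot-++ P S j p = begin
  nth (rot (length P) (P ++ S)) (suc j)     ≡⟨ cong (λ Y → nth Y (suc j)) (rot-++ P S) ⟩
  nth (S ++ P) (suc j)                      ≡⟨ sym (nth-++ˡ (S ++ P) S (suc j) (fits p)) ⟩
  nth ((S ++ P) ++ S) (suc j)               ≡⟨ sym (nth-++ʳ P ((S ++ P) ++ S) j) ⟩
  nth (P ++ (S ++ P) ++ S) (length P + suc j)
    ≡⟨ cong (λ Y → nth Y (length P + suc j)) reassociate ⟩
  nth ((P ++ S) ++ (P ++ S)) (length P + suc j) ∎
  where
  open ≡-Reasoning
  fits : suc j ≤ length (P ++ S) → suc j ≤ length (S ++ P)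
  fits q rewrite length-++-comm S P = q
  reassociate : P ++ (S ++ P) ++ S ≡ (P ++ S) ++ (P ++ S)
  reassociate = sym (trans (++-assoc P S (P ++ S)) (cong (P ++_) (sym (++-assoc S P S))))

nth-rot : (i j : ℕ) (X : List A) → i ≤ length X → suc j ≤ length X →
          nth (rot i X) (suc j) ≡ nth (X ++ X) (i + suc j)
nth-rot i j X p q with split-at i X p
... | P , S , refl , refl = nth-rot-++ P S j q

nth-rot-periodic : (F : ℕ → B) (n : ℕ) (X : List B) → length X ≡ n →
                   (∀ k → k < n → nth X (suc k) ≡ just (F (suc k))) →
                   (∀ k → F (k + n) ≡ F k) →
                   (i j : ℕ) → i ≤ n → suc j ≤ n → nth (rot i X) (suc j) ≡ just (F (i + suc j))
nth-rot-periodic F n X refl tab per i j p q = begin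
  nth (rot i X) (suc j)      ≡⟨ nth-rot i j X p q ⟩
  nth (X ++ X) (i + suc j)   ≡⟨ cong (nth (X ++ X)) (+-suc i j) ⟩
  nth (X ++ X) (suc (i + j)) ≡⟨ nth-twice (i + j) (subst (_≤ n + n) (+-suc i j) (+-mono-≤ p q)) ⟩
  just (F (suc (i + j)))     ≡⟨ cong (just ∘ F) (sym (+-suc i j)) ⟩
  just (F (i + suc j))       ∎
  where
  open ≡-Reasoning
  nth-twice : (k : ℕ) → suc k ≤ n + n → nth (X ++ X) (suc k) ≡ just (F (suc k))
  nth-twice k r with ≤-<-connex n k
  ... | inj₂ k<n = trans (nth-++ˡ X X (suc k) k<n) (tab k k<n)
  ... | inj₁ n≤k with m≤n⇒∃[o]m+o≡n n≤k
  ...   | m , refl = begin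
    nth (X ++ X) (suc (n + m)) ≡⟨ cong (nth (X ++ X)) (sym (+-suc n m)) ⟩
    nth (X ++ X) (n + suc m)   ≡⟨ nth-++ʳ X X m ⟩
    nth X (suc m)              ≡⟨ tab m m<n ⟩
    just (F (suc m))           ≡⟨ cong just (sym (per (suc m))) ⟩
    just (F (suc m + n))       ≡⟨ cong (just ∘ F ∘ suc) (+-comm m n) ⟩
    just (F (suc (n + m)))     ∎
    where
    m<n : m < n
    m<n = +-cancelˡ-≤ n (suc m) n (subst (_≤ n + n) (sym (+-suc n m)) r)

-- RTS(V)[i] computed from U = rot^i(V) and n = |V| alone.
rtsOfRotation : List Sym → ℕ → RTSSym
rtsOfRotation U n with last U
... | nothing       = nothing
... | just nothing  = nothing
... | just (just x) = just (rank∞ (PD U) n ⊖ rank∞ (drop 1 (PD (just x ∷ U))) n)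

nth-last-rot : (i : ℕ) (X : List A) → 1 ≤ i → i ≤ length X → nth X i ≡ last (rot i X)
nth-last-rot i X p q with split-at i X q
nth-last-rot _ _ () _ | [] , S , refl , refl
... | x ∷ P , S , refl , refl = begin
  nth ((x ∷ P) ++ S) (suc (length P)) ≡⟨ nth-++ˡ (x ∷ P) S (suc (length P)) ≤-refl ⟩
  nth (x ∷ P) (suc (length P))        ≡⟨ nth-length (x ∷ P) ⟩
  last (x ∷ P)                        ≡⟨ sym (last-++-∷ S x P) ⟩
  last (S ++ x ∷ P)                   ≡⟨ cong last (sym (rot-++ (x ∷ P) S)) ⟩
  last (rot (suc (length P)) ((x ∷ P) ++ S)) ∎
  where open ≡-Reasoning

rtsAt-rot : (V : List Sym) (i : ℕ) → nth V i ≡ last (rot i V) →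
            rtsAt V i ≡ rtsOfRotation (rot i V) (length V)
rtsAt-rot V i e with nth V i | last (rot i V) | e
... | nothing       | _ | refl = refl
... | just nothing  | _ | refl = refl
... | just (just x) | _ | refl = refl

length-RTS : (V : List Sym) → length (RTS V) ≡ length V
length-RTS V = trans (length-map _ (upTo (length V))) (length-upTo (length V))

nth-RTS : (V : List Sym) (k : ℕ) → k < length V →
          nth (RTS V) (suc k) ≡ just (rtsOfRotation (rot (suc k) V) (length V))
nth-RTS V k p = begin
  nth (RTS V) (suc k)                                      ≡⟨ nth-map _ (upTo (length V)) (suc k) ⟩
  mapMaybe (λ k → rtsAt V (suc k)) (nth (upTo (length V)) (suc k))
    ≡⟨ cong (mapMaybe _) (nth-applyUpTo (λ k → k) (length V) k p) ⟩
  just (rtsAt V (suc k))                                   ≡⟨ cong just (rtsAt-rot V (suc k) (nth-last-rot (suc k) V (s≤s z≤n) p)) ⟩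
  just (rtsOfRotation (rot (suc k) V) (length V))          ∎
  where open ≡-Reasoning

lemma28 : (σ : ℕ) (v : Sym) (vs : List Sym) → OverΣ$ σ (v ∷ vs) →
          (i j : ℕ) → 1 ≤ i → i ≤ length (v ∷ vs) → 1 ≤ j → j ≤ length (v ∷ vs) →
          nth (RTS (rot i (v ∷ vs))) j ≡ nth (rot i (RTS (v ∷ vs))) j
lemma28 _ v vs _ i (suc j) _ i≤n (s≤s z≤n) j<n = begin
  nth (RTS (rot i V)) (suc j)
    ≡⟨ nth-RTS (rot i V) j (subst (suc j ≤_) (sym (length-rot i V)) j<n) ⟩
  just (rtsOfRotation (rot (suc j) (rot i V)) (length (rot i V)))
    ≡⟨ cong₂ (λ U m → just (rtsOfRotation U m)) (sym (rot-+ (suc j) i V)) (length-rot i V) ⟩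
  just (F (suc j + i))          ≡⟨ cong (just ∘ F) (+-comm (suc j) i) ⟩
  just (F (i + suc j))          ≡⟨ sym (nth-rot-periodic F n (RTS V) (length-RTS V) (nth-RTS V) F-periodic i j i≤n j<n) ⟩
  nth (rot i (RTS V)) (suc j)   ∎
  where
  open ≡-Reasoning
  V : List Sym
  V = v ∷ vs
  n : ℕ
  n = length V
  F : ℕ → RTSSym
  F k = rtsOfRotation (rot k V) n
  F-periodic : ∀ k → F (k + n) ≡ F k
  F-periodic k = cong (λ U → rtsOfRotation U n) (trans (rot-+ k n V) (cong (rot k) (rot-length V)))
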